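{- Let $\mathbb{A}$ be a first-order expansion of $C^2_{\omega}=(A;E)$ preserved by an oligopotent quasi near-unanimity operation and by a ternary canonical operation $h$ with $h(N,\cdot,\cdot)=h(\cdot,N,\cdot)=h(\cdot,\cdot,N)=N$ which behaves like a minority on $\{E,=\}$. Then $\mathbb{A}$ pp-defines neither a $[(E(x_1,x_2)\Rightarrow x_3=x_4),(E^{=}(x_1,x_2)\wedge N(x_2,x_3)\wedge E^{=}(x_3,x_4))]$-relation nor a $[(x_1=x_2\Rightarrow E(x_3,x_4)),(E^{=}(x_1,x_2)\wedge N(x_2,x_3)\wedge E^{=}(x_3,x_4))]$-relation.
   Context: $C^2_{\omega}$ is the countable graph that is a disjoint union of countably infinitely many edges; it is homogeneous, and the orbits of pairs under its automorphism group are $E$, $N:=\{(a,b):a\ne b,(a,b)\notin E\}$ and $=$. $E^{=}:=E\cup\{(a,a):a\in A\}$. A first-order expansion is a structure $(A;E,R_1,\dots,R_k)$ over a finite relational signature with each $R_i$ first-order definable in $(A;E)$; by convention it contains $=$, and $N$ whenever $N$ is pp-definable in it. pp-definable: definable from atomic formulas and equality by conjunction and existential quantification. An operation preserves $\mathbb{A}$ if applied coordinatewise to tuples of any relation it yields a tuple of that relation. A $k$-ary $q$ is a quasi near-unanimity operation if $q(y,x,\dots,x)=q(x,y,x,\dots,x)=\dots=q(x,\dots,x,y)=q(x,\dots,x)$ for all $x,y$; oligopotent if $x\mapsto q(x,\dots,x)$ lies in the closure (pointwise convergence) of the monoid generated by the permutations of $A$ that are polymorphisms of $\mathbb{A}$.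 $h:A^3\to A$ is canonical if for all $m$, automorphisms $\alpha_1,\alpha_2,\alpha_3$ of $(A;E)$ and $m$-tuples $a_1,a_2,a_3$ there is an automorphism $\beta$ with $\beta(h(\alpha_1(a_1),\alpha_2(a_2),\alpha_3(a_3)))=h(a_1,a_2,a_3)$; then $h(O_1,O_2,O_3)$ for $O_i\in\{E,N,=\}$ denotes the orbit of $(h(a_1,a_2,a_3),h(b_1,b_2,b_3))$ for any $(a_i,b_i)\in O_i$. $h(N,\cdot,\cdot)=N$ means $h(N,O_2,O_3)=N$ for all $O_2,O_3$ (similarly for other positions). Behaving like a minority on $\{E,=\}$ means $h(E,E,E)=h(E,=,=)=h(=,E,=)=h(=,=,E)=E$ and $h(=,=,=)=h(=,E,E)=h(E,=,E)=h(E,E,=)$ is $=$. A quaternary $R$ entails $\varphi$ if all its tuples satisfy it; it efficiently entails $(S_1(x_1,x_2)\Rightarrow S_2(x_3,x_4))$ if it entails it and contains $t_1$ with $(t_1[1],t_1[2])\in S_1,(t_1[3],t_1[4])\in S_2$ and $t_2$ with $(t_2[1],t_2[2])\notin S_1,(t_2[3],t_2[4])\notin S_2$. A $[(S_1\Rightarrow S_2),(\varphi)]$-relation efficiently entails the implication and entails $\varphi$. -}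

module Defs where

open import Data.Nat using (ℕ; suc)
open import Data.Bool using (Bool)
open import Data.Unit using (⊤)
open import Data.Fin using (Fin; zero; suc; _≟_)
open import Data.Product using (Σ; _×_; _,_; ∃)
open import Data.List using (List; []; _∷_)
open import Data.List.Membership.Propositional using (_∈_)
open import Relation.Nullary using (¬_; yes; no)
open import Relation.Binary.PropositionalEquality using (_≡_; _≢_)
open import Function using (id; _∘_; _⇔_)
open import Function.Bundles using (_↔_; Inverse)

-- The graph C²_ω : vertices ℕ × Bool, the edges are {(n,false),(n,true)}

A : Set
A = ℕ × Bool

E : A → A → Set
E (n , b) (m , c) = (n ≡ m) × (b ≢ c)

N : A → A → Set
N a b = (a ≢ b) × ¬ E a b

data E⁼ (a b : A) : Set where
  isEdge : E a b → E⁼ a b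
  isEq   : a ≡ b → E⁼ a b

Rel : ℕ → Set₁
Rel k = (Fin k → A) → Set

data FO (n : ℕ) : Set where
  eqF   : Fin n → Fin n → FO n
  edgeF : Fin n → Fin n → FO n
  notF  : FO n → FO n
  andF  : FO n → FO n → FO n
  exF   : FO (suc n) → FO n

extend : ∀ {n} → (Fin n → A) → A → Fin (suc n) → A
extend env a zero    = a
extend env a (suc i) = env i

⟦_⟧FO : ∀ {n} → FO n → (Fin n → A) → Set
⟦ eqF i j ⟧FO env   = env i ≡ env j
⟦ edgeF i j ⟧FO env = E (env i) (env j)
⟦ notF φ ⟧FO env    = ¬ ⟦ φ ⟧FO env
⟦ andF φ ψ ⟧FO env  = ⟦ φ ⟧FO env × ⟦ ψ ⟧FO env
⟦ exF φ ⟧FO env     = Σ A λ a → ⟦ φ ⟧FO (extend env a)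

FODefinable : ∀ {k} → Rel k → Set
FODefinable {k} R = Σ (FO k) λ φ → ∀ t → R t ⇔ ⟦ φ ⟧FO t

record Expansion : Set₁ where
  field
    k     : ℕ
    arity : Fin k → ℕ
    rel   : (i : Fin k) → Rel (arity i)
    fodef : (i : Fin k) → FODefinable (rel i)

open Expansion public

data PP (𝔸 : Expansion) (n : ℕ) : Set where
  topP  : PP 𝔸 n
  eqP   : Fin n → Fin n → PP 𝔸 n
  edgeP : Fin n → Fin n → PP 𝔸 n
  relP  : (i : Fin (k 𝔸)) → (Fin (arity 𝔸 i) → Fin n) → PP 𝔸 n
  andP  : PP 𝔸 n → PP 𝔸 n → PP 𝔸 n
  exP   : PP 𝔸 (suc n) → PP 𝔸 n

⟦_⟧PP : ∀ {𝔸 n} → PP 𝔸 n → (Fin n → A) → Set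
⟦ topP ⟧PP env              = ⊤
⟦ eqP i j ⟧PP env           = env i ≡ env j
⟦ edgeP i j ⟧PP env         = E (env i) (env j)
⟦_⟧PP {𝔸} (relP i xs) env   = rel 𝔸 i (env ∘ xs)
⟦ andP φ ψ ⟧PP env          = ⟦ φ ⟧PP env × ⟦ ψ ⟧PP env
⟦ exP φ ⟧PP env             = Σ A λ a → ⟦ φ ⟧PP (extend env a)

Op : ℕ → Set
Op m = (Fin m → A) → A

Preserves : ∀ {m r} → Op m → Rel r → Set
Preserves {m} {r} f R =
  (t : Fin m → Fin r → A) → (∀ j → R (t j)) → R (λ l → f (λ j → t j l))

ERel : Rel 2
ERel t = E (t zero) (t (suc zero))

-- f preserves 𝔸 (i.e. E and every R_i; equality is always preserved)
IsPolymorphism : ∀ {m} → Expansion → Op m → Set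
IsPolymorphism 𝔸 f = Preserves f ERel × ((i : Fin (k 𝔸)) → Preserves f (rel 𝔸 i))

oneY : ∀ {k} → A → A → Fin k → Fin k → A
oneY x y i j with j ≟ i
... | yes _ = y
... | no  _ = x

IsQNU : ∀ {k} → Op k → Set
IsQNU {k} q = ∀ (x y : A) (i : Fin k) → q (oneY x y i) ≡ q (λ _ → x)

PolyPerm : Expansion → Set
PolyPerm 𝔸 = Σ (A ↔ A) λ π → IsPolymorphism {1} 𝔸 (λ x → Inverse.to π (x zero))

compose : (𝔸 : Expansion) → List (PolyPerm 𝔸) → A → A
compose 𝔸 []             = id
compose 𝔸 ((π , _) ∷ ps) = Inverse.to π ∘ compose 𝔸 ps

-- g lies in the closure (pointwise convergence topology) of the monoid
-- generated by the permutational polymorphisms: every finite set of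
-- arguments is matched by some finite composite of generators
InClosurePermMonoid : Expansion → (A → A) → Set
InClosurePermMonoid 𝔸 g =
  (S : List A) → Σ (List (PolyPerm 𝔸)) λ ps → ∀ a → a ∈ S → compose 𝔸 ps a ≡ g a

IsOligopotent : ∀ {k} → Expansion → Op k → Set
IsOligopotent {k} 𝔸 q = InClosurePermMonoid 𝔸 (λ x → q (λ _ → x))

Aut : Set
Aut = Σ (A ↔ A) λ α → ∀ a b → E a b ⇔ E (Inverse.to α a) (Inverse.to α b)

app : Aut → A → A
app (α , _) = Inverse.to α

IsCanonical : (A → A → A → A) → Set
IsCanonical h =
  ∀ (m : ℕ) (α₁ α₂ α₃ : Aut) (a₁ a₂ a₃ : Fin m → A) →
    Σ Aut λ β → ∀ j →
      app β (h (app α₁ (a₁ j)) (app α₂ (a₂ j)) (app α₃ (a₃ j))) ≡ h (a₁ j) (a₂ j) (a₃ j)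

-- the three orbits of pairs
data Orbit : Set where
  oE oN oEq : Orbit

InOrbit : Orbit → A → A → Set
InOrbit oE  a b = E a b
InOrbit oN  a b = N a b
InOrbit oEq a b = a ≡ b

HOrb : (A → A → A → A) → Orbit → Orbit → Orbit → Orbit → Set
HOrb h O₁ O₂ O₃ O =
  ∀ a₁ b₁ a₂ b₂ a₃ b₃ → InOrbit O₁ a₁ b₁ → InOrbit O₂ a₂ b₂ → InOrbit O₃ a₃ b₃ →
    InOrbit O (h a₁ a₂ a₃) (h b₁ b₂ b₃)

NAbsorbing : (A → A → A → A) → Set
NAbsorbing h = ∀ O₂ O₃ → HOrb h oN O₂ O₃ oN × HOrb h O₂ oN O₃ oN × HOrb h O₂ O₃ oN oN

MinorityOnEEq : (A → A → A → A) → Set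
MinorityOnEEq h =
  HOrb h oE oE oE oE × HOrb h oE oEq oEq oE × HOrb h oEq oE oEq oE × HOrb h oEq oEq oE oE ×
  HOrb h oEq oEq oEq oEq × HOrb h oEq oE oE oEq × HOrb h oE oEq oE oEq × HOrb h oE oE oEq oEq

ternary : (A → A → A → A) → Op 3
ternary h x = h (x zero) (x (suc zero)) (x (suc (suc zero)))

x₁ x₂ x₃ x₄ : Fin 4
x₁ = zero
x₂ = suc zero
x₃ = suc (suc zero)
x₄ = suc (suc (suc zero))

EfficientlyEntails : Rel 4 → (A → A → Set) → (A → A → Set) → Set
EfficientlyEntails R S₁ S₂ =
  (∀ t → R t → S₁ (t x₁) (t x₂) → S₂ (t x₃) (t x₄)) ×
  (Σ (Fin 4 → A) λ t → R t × S₁ (t x₁) (t x₂) × S₂ (t x₃) (t x₄)) ×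
  (Σ (Fin 4 → A) λ t → R t × ¬ S₁ (t x₁) (t x₂) × ¬ S₂ (t x₃) (t x₄))

Entails : Rel 4 → Rel 4 → Set
Entails R φ = ∀ t → R t → φ t

IsImplRelation : (A → A → Set) → (A → A → Set) → Rel 4 → Rel 4 → Set
IsImplRelation S₁ S₂ φ R = EfficientlyEntails R S₁ S₂ × Entails R φ

φ₀ : Rel 4
φ₀ t = E⁼ (t x₁) (t x₂) × N (t x₂) (t x₃) × E⁼ (t x₃) (t x₄)

PPDefinesImplRelation : Expansion → (A → A → Set) → (A → A → Set) → Rel 4 → Set
PPDefinesImplRelation 𝔸 S₁ S₂ φ = Σ (PP 𝔸 4) λ ψ → IsImplRelation S₁ S₂ φ (⟦_⟧PP {𝔸} ψ)

module Submission where

-- Every vertex (n , b) of C²_ω lies on the edge {(n , false) , (n , true)}, so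
-- a pair of vertices joined by E or by = is recorded faithfully by the xor of
-- its two sides ("parity" true for E, false for =).
--
--  1. pp-definable relations are invariant under the edge-preserving involutions
--     of A (component swaps, side flips) and preserved by all polymorphisms.
--  2. Using 1, a pp-definable R containing a tuple of shape E(x₁,x₂) ∧ x₃ = x₄
--     (resp. x₁ = x₂ ∧ E(x₃,x₄)) with N(x₂,x₃) contains the normal forms
--     ((0,1),(0,0),(1,s),(1,s)) (resp. ((0,0),(0,0),(1,s),(1,¬s))) for all s.
--  3. A relation is odd if on each tuple exactly one of the pairs (x₁,x₂),
--     (x₃,x₄) has parity true.  An odd relation containing all these normal
--     forms is not preserved by any quasi near-unanimity operation: applying it
--     to m suitable rows forces the sides of a chain w₀,…,w_m to alternate,
--     against the values forced on w₀ and w_m.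
--  4. Both kinds of relations in the theorem are odd: the only bad cases are
--     excluded by the implication itself, after combining with the two shape
--     witnesses through the minority-like operation h.

open import Defs
open import Data.Nat using (ℕ; zero; suc; _<_; _≡ᵇ_; _<ᵇ_)
open import Data.Nat.Properties using (_≟_; n<1+n; m<n⇒m<1+n; <⇒<ᵇ)
open import Data.Bool using (Bool; true; false; not; _xor_; _∧_) renaming (_≟_ to _≟ᵇ_)
open import Data.Bool.Properties
  using (xor-same; xor-assoc; xor-comm; xor-identityʳ; not-distribˡ-xor; not-distribʳ-xor; not-¬; T-≡)
open import Data.Fin using (Fin; zero; suc; toℕ; fromℕ<) renaming (_≟_ to _≟ᶠ_)
open import Data.Fin.Properties using (toℕ-injective; toℕ-fromℕ<; toℕ<n)
open import Data.Vec.Functional using ([]; _∷_)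
open import Data.Product using (_×_; _,_; proj₁; proj₂)
open import Data.Unit using (tt)
open import Data.Empty using (⊥; ⊥-elim)
open import Relation.Nullary using (¬_; yes; no)
open import Relation.Binary.PropositionalEquality
  using (_≡_; _≢_; refl; sym; trans; cong; cong₂; subst; subst₂; module ≡-Reasoning)
open import Function using (_∘_)
open import Function.Bundles using (Equivalence)

side : A → Bool
side = proj₂

parity : A → A → Bool
parity a b = side a xor side b

≢⇒xor≡true : ∀ {x y : Bool} → x ≢ y → x xor y ≡ true
≢⇒xor≡true {true}  {true}  x≢y = ⊥-elim (x≢y refl)
≢⇒xor≡true {true}  {false} _   = refl
≢⇒xor≡true {false} {true}  _   = refl
≢⇒xor≡true {false} {false} x≢y = ⊥-elim (x≢y refl)

xor≡true⇒≡not : ∀ x y → x xor y ≡ true → y ≡ not x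
xor≡true⇒≡not true  false _ = refl
xor≡true⇒≡not false true  _ = refl
xor≡true⇒≡not true  true  ()
xor≡true⇒≡not false false ()

xor-cancelʳ : ∀ x y → (x xor y) xor y ≡ x
xor-cancelʳ x y = trans (xor-assoc x y y) (trans (cong (x xor_) (xor-same y)) (xor-identityʳ x))

xor-cancelˡ : ∀ x y → x xor (x xor y) ≡ y
xor-cancelˡ x y = trans (sym (xor-assoc x x y)) (cong (_xor y) (xor-same x))

parity-E : ∀ {a b} → E a b → parity a b ≡ true
parity-E (_ , sides≢) = ≢⇒xor≡true sides≢

parity-≡ : ∀ {a b} → a ≡ b → parity a b ≡ false
parity-≡ {a} refl = xor-same (side a)

E-sym : ∀ {a b} → E a b → E b a
E-sym (same , sides≢) = sym same , sides≢ ∘ sym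

E-irrefl : ∀ {a} → ¬ E a a
E-irrefl (_ , sides≢) = sides≢ refl

partner : A → A
partner (n , b) = n , not b

E-partner : ∀ a → E a (partner a)
E-partner (n , b) = refl , not-¬ refl

E-functional : ∀ {a b c} → E a c → E b c → a ≡ b
E-functional {n , x} {.n , y} {.n , z} (refl , x≢z) (refl , y≢z) = cong (n ,_) (bool x y z x≢z y≢z)
  where
    bool : ∀ x y z → x ≢ z → y ≢ z → x ≡ y
    bool true  true  _     _   _   = refl
    bool false false _     _   _   = refl
    bool true  false true  x≢z _   = ⊥-elim (x≢z refl)
    bool true  false false _   y≢z = ⊥-elim (y≢z refl)
    bool false true  true  _   y≢z = ⊥-elim (y≢z refl)
    bool false true  false x≢z _   = ⊥-elim (x≢z refl)

N⇒differentEdges : ∀ {a b} → N a b → proj₁ a ≢ proj₁ b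
N⇒differentEdges {n , x} {.n , y} (a≢b , ¬E) refl with x ≟ᵇ y
... | yes refl = a≢b refl
... | no x≢y   = ¬E (refl , x≢y)

E⁼-¬E : ∀ {a b} → E⁼ a b → ¬ E a b → a ≡ b
E⁼-¬E (isEdge e) ¬e = ⊥-elim (¬e e)
E⁼-¬E (isEq eq)  _  = eq

E⁼-≢ : ∀ {a b} → E⁼ a b → a ≢ b → E a b
E⁼-≢ (isEdge e) _   = e
E⁼-≢ (isEq eq)  a≢b = ⊥-elim (a≢b eq)

-- involutive edge-preserving maps of A; these are automorphisms of (A;E)
-- whose inverse is themselves, which keeps the invariance proof symmetric
record EdgeInvolution : Set where
  field
    apply      : A → A
    involutive : ∀ a → apply (apply a) ≡ a
    preservesE : ∀ {a b} → E a b → E (apply a) (apply b)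

open EdgeInvolution

-- R is invariant if it is closed under every edge-preserving involution,
-- stated up to pointwise equality of tuples (there is no function extensionality)
Invariant : ∀ {n} → Rel n → Set
Invariant R = ∀ (I : EdgeInvolution) {t t′} → (∀ i → t′ i ≡ apply I (t i)) → R t → R t′

idInvolution : EdgeInvolution
idInvolution = record { apply = λ a → a ; involutive = λ _ → refl ; preservesE = λ e → e }

extend-apply : ∀ {n} (I : EdgeInvolution) {t t′ : Fin n → A} → (∀ i → t′ i ≡ apply I (t i)) →
               ∀ a i → extend t′ (apply I a) i ≡ apply I (extend t a i)
extend-apply I t′≡ a zero    = refl
extend-apply I t′≡ a (suc i) = t′≡ i

-- first-order definable relations are invariant (negation needs I⁻¹ = I)
foInvariant : ∀ {n} (φ : FO n) → Invariant ⟦ φ ⟧FO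
foInvariant (eqF i j) I t′≡ p = trans (t′≡ i) (trans (cong (apply I) p) (sym (t′≡ j)))
foInvariant (edgeF i j) I t′≡ p = subst₂ E (sym (t′≡ i)) (sym (t′≡ j)) (preservesE I p)
foInvariant (notF φ) I {t} {t′} t′≡ ¬p p′ = ¬p (foInvariant φ I t≡ p′)
  where
    t≡ : ∀ i → t i ≡ apply I (t′ i)
    t≡ i = trans (sym (involutive I (t i))) (cong (apply I) (sym (t′≡ i)))
foInvariant (andF φ ψ) I t′≡ (p , q) = foInvariant φ I t′≡ p , foInvariant ψ I t′≡ q
foInvariant (exF φ) I t′≡ (a , p) = apply I a , foInvariant φ I (extend-apply I t′≡ a) p

-- pp-definable relations are invariant; the relations of 𝔸 via their FO definitions
ppInvariant : ∀ {𝔸 n} (ψ : PP 𝔸 n) → Invariant ⟦ ψ ⟧PP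
ppInvariant topP I t′≡ p = tt
ppInvariant (eqP i j) I t′≡ p = trans (t′≡ i) (trans (cong (apply I) p) (sym (t′≡ j)))
ppInvariant (edgeP i j) I t′≡ p = subst₂ E (sym (t′≡ i)) (sym (t′≡ j)) (preservesE I p)
ppInvariant {𝔸} (relP r xs) I {t} {t′} t′≡ p =
  Equivalence.from (proj₂ (fodef 𝔸 r) (t′ ∘ xs))
    (foInvariant (proj₁ (fodef 𝔸 r)) I (t′≡ ∘ xs) (Equivalence.to (proj₂ (fodef 𝔸 r) (t ∘ xs)) p))
ppInvariant (andP φ ψ) I t′≡ (p , q) = ppInvariant φ I t′≡ p , ppInvariant ψ I t′≡ q
ppInvariant (exP φ) I t′≡ (a , p) = apply I a , ppInvariant φ I (extend-apply I t′≡ a) p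

ppRespects : ∀ {𝔸 n} (ψ : PP 𝔸 n) {t t′} → (∀ i → t′ i ≡ t i) → ⟦ ψ ⟧PP t → ⟦ ψ ⟧PP t′
ppRespects ψ = ppInvariant ψ idInvolution

-- an operation preserving E respects equality: q u and q v share the neighbour
-- q (partner ∘ u)
congOp : ∀ {m} (g : Op m) → Preserves g ERel → ∀ {u v} → (∀ j → u j ≡ v j) → g u ≡ g v
congOp g gE {u} {v} u≡v = E-functional edge-u edge-v
  where
    edge-u : E (g u) (g (partner ∘ u))
    edge-u = gE (λ j → u j ∷ partner (u j) ∷ []) (λ j → E-partner (u j))
    edge-v : E (g v) (g (partner ∘ u))
    edge-v = gE (λ j → v j ∷ partner (u j) ∷ []) (λ j → subst (λ a → E a (partner (u j))) (u≡v j) (E-partner (u j)))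

ppPreserved : ∀ {𝔸 m n} (g : Op m) → IsPolymorphism 𝔸 g → (ψ : PP 𝔸 n) → Preserves g ⟦ ψ ⟧PP
ppPreserved g pol topP t ts = tt
ppPreserved g pol (eqP i j) t ts = congOp g (proj₁ pol) ts
ppPreserved g pol (edgeP i j) t ts = proj₁ pol (λ k → t k i ∷ t k j ∷ []) ts
ppPreserved g pol (relP r xs) t ts = proj₂ pol r (λ k → t k ∘ xs) ts
ppPreserved g pol (andP φ ψ) t ts =
  ppPreserved g pol φ t (λ k → proj₁ (ts k)) , ppPreserved g pol ψ t (λ k → proj₂ (ts k))
ppPreserved g pol (exP φ) t ts =
  g (λ k → proj₁ (ts k)) ,
  ppRespects φ (λ { zero → refl ; (suc i) → refl })
    (ppPreserved g pol φ (λ k → extend (t k) (proj₁ (ts k))) (λ k → proj₂ (ts k)))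

swap : ℕ → ℕ → ℕ → ℕ
swap a b n with n ≟ a | n ≟ b
... | yes _ | _     = b
... | no _  | yes _ = a
... | no _  | no _  = n

swap-left : ∀ a b → swap a b a ≡ b
swap-left a b with a ≟ a | a ≟ b
... | yes _   | _ = refl
... | no a≢a  | _ = ⊥-elim (a≢a refl)

swap-right : ∀ a b → swap a b b ≡ a
swap-right a b with b ≟ a | b ≟ b
... | yes b≡a | _       = b≡a
... | no _    | yes _   = refl
... | no _    | no b≢b  = ⊥-elim (b≢b refl)

swap-other : ∀ a b n → n ≢ a → n ≢ b → swap a b n ≡ n
swap-other a b n n≢a n≢b with n ≟ a | n ≟ b
... | yes n≡a | _       = ⊥-elim (n≢a n≡a)
... | no _    | yes n≡b = ⊥-elim (n≢b n≡b)
... | no _    | no _    = refl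

swap-involutive : ∀ a b n → swap a b (swap a b n) ≡ n
swap-involutive a b n with n ≟ a | n ≟ b
... | yes refl | _        = swap-right n b
... | no _     | yes refl = swap-left a n
... | no n≢a   | no n≢b   = swap-other a b n n≢a n≢b

swapEdges : ℕ → ℕ → EdgeInvolution
swapEdges a b = record
  { apply      = λ { (n , c) → swap a b n , c }
  ; involutive = λ { (n , c) → cong (_, c) (swap-involutive a b n) }
  ; preservesE = λ { (same , sides≢) → cong (swap a b) same , sides≢ }
  }

flipEdge : ℕ → Bool → EdgeInvolution
flipEdge k β = record
  { apply      = flip
  ; involutive = λ { (n , c) → cong (n ,_) (xor-cancelˡ ((n ≡ᵇ k) ∧ β) c) }
  ; preservesE = λ { {n , x} {.n , y} (refl , x≢y) → refl , λ eq → x≢y (xor-injective ((n ≡ᵇ k) ∧ β) eq) }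
  }
  where
    flip : A → A
    flip (n , c) = n , ((n ≡ᵇ k) ∧ β) xor c
    xor-injective : ∀ z {x y} → z xor x ≡ z xor y → x ≡ y
    xor-injective z {x} {y} eq =
      trans (sym (xor-cancelˡ z x)) (trans (cong (z xor_) eq) (xor-cancelˡ z y))

edgeEqNF eqEdgeNF : Bool → Fin 4 → A
edgeEqNF s = (0 , true)  ∷ (0 , false) ∷ (1 , s) ∷ (1 , s)     ∷ []
eqEdgeNF s = (0 , false) ∷ (0 , false) ∷ (1 , s) ∷ (1 , not s) ∷ []

EdgeEq EqEdge : Rel 4
EdgeEq t = E (t x₁) (t x₂) × t x₃ ≡ t x₄
EqEdge t = t x₁ ≡ t x₂ × E (t x₃) (t x₄)

module Normaliser (P Q : ℕ) (P≢Q : P ≢ Q) (b₀ b₁ : Bool) where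

  Q′ : ℕ
  Q′ = swap P 0 Q

  normalise : A → A
  normalise = apply (flipEdge 1 b₁) ∘ apply (flipEdge 0 b₀) ∘ apply (swapEdges Q′ 1) ∘ apply (swapEdges P 0)

  normalise-invariant : ∀ {n} {R : Rel n} → Invariant R →
                        ∀ {t t′} → (∀ i → t′ i ≡ normalise (t i)) → R t → R t′
  normalise-invariant inv t′≡ =
    inv (flipEdge 1 b₁) t′≡ ∘ inv (flipEdge 0 b₀) (λ _ → refl) ∘
    inv (swapEdges Q′ 1) (λ _ → refl) ∘ inv (swapEdges P 0) (λ _ → refl)

  0≢Q′ : 0 ≢ Q′
  0≢Q′ 0≡Q′ = P≢Q (trans (sym (swap-right P 0)) (trans (cong (swap P 0) 0≡Q′) (swap-involutive P 0 Q)))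

  normalise-P : ∀ a → proj₁ a ≡ P → normalise a ≡ (0 , b₀ xor side a)
  normalise-P (.P , c) refl rewrite swap-left P 0 | swap-other Q′ 1 0 0≢Q′ (λ ()) = refl

  normalise-Q : ∀ a → proj₁ a ≡ Q → normalise a ≡ (1 , b₁ xor side a)
  normalise-Q (.Q , c) refl rewrite swap-left Q′ 1 = refl

toEdgeEqNF : ∀ {R : Rel 4} → Invariant R → ∀ {t} → R t → EdgeEq t → N (t x₂) (t x₃) →
             ∀ s → R (edgeEqNF s)
toEdgeEqNF inv {t} r (E₁₂ , eq₃₄) N₂₃ s = normalise-invariant inv nf r
  where
    open Normaliser (proj₁ (t x₂)) (proj₁ (t x₃)) (N⇒differentEdges N₂₃) (side (t x₂)) (s xor side (t x₃))
    at-x₃ : normalise (t x₃) ≡ (1 , s)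
    at-x₃ = trans (normalise-Q (t x₃) refl) (cong (1 ,_) (xor-cancelʳ s (side (t x₃))))
    nf : ∀ i → edgeEqNF s i ≡ normalise (t i)
    nf zero                   = sym (trans (normalise-P (t x₁) (proj₁ E₁₂)) (cong (0 ,_) (parity-E (E-sym E₁₂))))
    nf (suc zero)             = sym (trans (normalise-P (t x₂) refl) (cong (0 ,_) (parity-≡ {t x₂} refl)))
    nf (suc (suc zero))       = sym at-x₃
    nf (suc (suc (suc zero))) = sym (trans (cong normalise (sym eq₃₄)) at-x₃)

toEqEdgeNF : ∀ {R : Rel 4} → Invariant R → ∀ {t} → R t → EqEdge t → N (t x₂) (t x₃) →
             ∀ s → R (eqEdgeNF s)
toEqEdgeNF inv {t} r (eq₁₂ , E₃₄) N₂₃ s = normalise-invariant inv nf r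
  where
    open Normaliser (proj₁ (t x₂)) (proj₁ (t x₃)) (N⇒differentEdges N₂₃) (side (t x₂)) (s xor side (t x₃))
    at-x₂ : normalise (t x₂) ≡ (0 , false)
    at-x₂ = trans (normalise-P (t x₂) refl) (cong (0 ,_) (parity-≡ {t x₂} refl))
    opposite : (s xor side (t x₃)) xor side (t x₄) ≡ not s
    opposite = trans (xor-assoc s (side (t x₃)) (side (t x₄)))
                 (trans (cong (s xor_) (parity-E E₃₄)) (xor-comm s true))
    nf : ∀ i → eqEdgeNF s i ≡ normalise (t i)
    nf zero                   = sym (trans (cong normalise eq₁₂) at-x₂)
    nf (suc zero)             = sym at-x₂
    nf (suc (suc zero))       = sym (trans (normalise-Q (t x₃) refl) (cong (1 ,_) (xor-cancelʳ s (side (t x₃)))))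
    nf (suc (suc (suc zero))) = sym (trans (normalise-Q (t x₄) (sym (proj₁ E₃₄))) (cong (1 ,_) opposite))

Odd : Rel 4 → Set
Odd R = ∀ t → R t → parity (t x₁) (t x₂) xor parity (t x₃) (t x₄) ≡ true

par : ℕ → Bool
par zero    = false
par (suc n) = not (par n)

alternating : ∀ (b : ℕ → Bool) n → (∀ k → k < n → b (suc k) ≡ not (b k)) → b n ≡ b 0 xor par n
alternating b zero    _   = sym (xor-identityʳ (b 0))
alternating b (suc n) alt = begin
  b (suc n)            ≡⟨ alt n (n<1+n n) ⟩
  not (b n)            ≡⟨ cong not (alternating b n (λ k k<n → alt k (m<n⇒m<1+n k<n))) ⟩
  not (b 0 xor par n)  ≡⟨ not-distribʳ-xor (b 0) (par n) ⟩
  b 0 xor not (par n)  ∎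
  where open ≡-Reasoning

<ᵇ-irrefl : ∀ k → (k <ᵇ k) ≡ false
<ᵇ-irrefl zero    = refl
<ᵇ-irrefl (suc k) = <ᵇ-irrefl k

<ᵇ-skip : ∀ j k → j ≢ k → (j <ᵇ suc k) ≡ (j <ᵇ k)
<ᵇ-skip zero    zero    j≢k = ⊥-elim (j≢k refl)
<ᵇ-skip zero    (suc k) _   = refl
<ᵇ-skip (suc j) zero    _   = refl
<ᵇ-skip (suc j) (suc k) j≢k = <ᵇ-skip j k (j≢k ∘ cong suc)

<⇒<ᵇ≡true : ∀ {j k} → j < k → (j <ᵇ k) ≡ true
<⇒<ᵇ≡true j<k = Equivalence.to T-≡ (<⇒<ᵇ j<k)

-- entry j k = parity of #{l < k ∣ l ≠ j}: the side used in column j of row k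
entry : ℕ → ℕ → Bool
entry j k = par k xor (j <ᵇ k)

entry-diagonal : ∀ k → entry k (suc k) ≡ entry k k
entry-diagonal k rewrite <⇒<ᵇ≡true (n<1+n k) | <ᵇ-irrefl k = flip-twice (par k)
  where
    flip-twice : ∀ x → not x xor true ≡ x xor false
    flip-twice true  = refl
    flip-twice false = refl

entry-off : ∀ j k → j ≢ k → entry j (suc k) ≡ not (entry j k)
entry-off j k j≢k rewrite <ᵇ-skip j k j≢k = sym (not-distribˡ-xor (par k) (j <ᵇ k))

entry-final : ∀ j m → j < m → entry j m ≡ not (par m)
entry-final j m j<m rewrite <⇒<ᵇ≡true j<m = xor-comm (par m) true

-- For each i < m, q is applied to row i, the m-tuple of normal forms whose
-- j-th member is an edgeEq form if j = i and an eqEdge form otherwise, with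
-- sides chosen so that the x₄-coordinates of row i are the x₃-coordinates of
-- row i+1.
module QNUObstruction {m} (q : Op m) (qE : Preserves q ERel) (qnu : IsQNU q)
                      {R : Rel 4} (qR : Preserves q R) (odd : Odd R)
                      (edgeEq : ∀ s → R (edgeEqNF s)) (eqEdge : ∀ s → R (eqEdgeNF s)) where

  row : Fin m → Fin m → Fin 4 → A
  row i j with j ≟ᶠ i
  ... | yes _ = edgeEqNF (entry (toℕ j) (toℕ i))
  ... | no _  = eqEdgeNF (entry (toℕ j) (toℕ i))

  row-in-R : ∀ i j → R (row i j)
  row-in-R i j with j ≟ᶠ i
  ... | yes _ = edgeEq _
  ... | no _  = eqEdge _

  row-x₁ : ∀ i j → row i j x₁ ≡ oneY (0 , false) (0 , true) i j
  row-x₁ i j with j ≟ᶠ i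
  ... | yes _ = refl
  ... | no _  = refl

  row-x₂ : ∀ i j → row i j x₂ ≡ (0 , false)
  row-x₂ i j with j ≟ᶠ i
  ... | yes _ = refl
  ... | no _  = refl

  row-x₃ : ∀ i j → row i j x₃ ≡ (1 , entry (toℕ j) (toℕ i))
  row-x₃ i j with j ≟ᶠ i
  ... | yes _ = refl
  ... | no _  = refl

  row-x₄ : ∀ i j → row i j x₄ ≡ (1 , entry (toℕ j) (suc (toℕ i)))
  row-x₄ i j with j ≟ᶠ i
  ... | yes refl = cong (1 ,_) (sym (entry-diagonal (toℕ j)))
  ... | no j≢i   = cong (1 ,_) (sym (entry-off (toℕ j) (toℕ i) (j≢i ∘ toℕ-injective)))

  w : ℕ → A
  w k = q (λ j → 1 , entry (toℕ j) k)

  -- q maps row i to a tuple of R whose first pair is constant by quasi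
  -- near-unanimity, so by oddness w i and w (i+1) form an edge
  alternates : ∀ i → side (w (suc (toℕ i))) ≡ not (side (w (toℕ i)))
  alternates i =
    xor≡true⇒≡not _ _
      (subst₂ (λ a b → parity a b ≡ true) (congOp q qE (row-x₃ i)) (congOp q qE (row-x₄ i)) second-edge)
    where
      u : Fin 4 → A
      u c = q (λ j → row i j c)
      first-constant : parity (u x₁) (u x₂) ≡ false
      first-constant =
        parity-≡ (trans (trans (congOp q qE (row-x₁ i)) (qnu _ _ i)) (sym (congOp q qE (row-x₂ i))))
      second-edge : parity (u x₃) (u x₄) ≡ true
      second-edge =
        subst (λ b → b xor parity (u x₃) (u x₄) ≡ true) first-constant (odd u (qR (row i) (row-in-R i)))

  -- w 0 = q(1,0,…,0) and w m = q(1,¬p,…,1,¬p) cannot be p steps apart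
  ends-disagree : ∀ p → side (q (λ _ → 1 , not p)) ≢ side (q (λ _ → 1 , false)) xor p
  ends-disagree true  eq = not-¬ refl (trans eq (xor-comm _ true))
  ends-disagree false eq = not-¬ refl (trans (sym (trans eq (xor-identityʳ _))) opposite)
    where
      opposite : side (q (λ _ → 1 , true)) ≡ not (side (q (λ _ → 1 , false)))
      opposite =
        xor≡true⇒≡not _ _ (parity-E (qE (λ _ → (1 , false) ∷ (1 , true) ∷ []) (λ _ → E-partner (1 , false))))

  contradiction : ⊥
  contradiction = ends-disagree (par m) (begin
    side (q (λ _ → 1 , not (par m)))  ≡⟨ cong side (sym w-final) ⟩
    side (w m)                        ≡⟨ alternating (side ∘ w) m alternates-below ⟩
    side (w 0) xor par m              ∎)
    where
      open ≡-Reasoning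
      w-final : w m ≡ q (λ _ → 1 , not (par m))
      w-final = congOp q qE (λ j → cong (1 ,_) (entry-final (toℕ j) m (toℕ<n j)))
      alternates-below : ∀ k → k < m → side (w (suc k)) ≡ not (side (w k))
      alternates-below k k<m =
        subst (λ l → side (w (suc l)) ≡ not (side (w l))) (toℕ-fromℕ< k<m) (alternates (fromℕ< k<m))

oddRelationNotPreserved : ∀ {𝔸 m} (q : Op m) → IsPolymorphism 𝔸 q → IsQNU q →
                          (ψ : PP 𝔸 4) → Odd ⟦ ψ ⟧PP → Entails ⟦ ψ ⟧PP φ₀ →
                          ∀ {tA tB} → ⟦ ψ ⟧PP tA → EdgeEq tA → ⟦ ψ ⟧PP tB → EqEdge tB → ⊥
oddRelationNotPreserved q qPol qnu ψ odd ent rA shapeA rB shapeB =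
  QNUObstruction.contradiction q (proj₁ qPol) qnu (ppPreserved q qPol ψ) odd
    (toEdgeEqNF (ppInvariant ψ) rA shapeA (N₂₃ rA))
    (toEqEdgeNF (ppInvariant ψ) rB shapeB (N₂₃ rB))
  where
    N₂₃ : ∀ {t} → ⟦ ψ ⟧PP t → N (t x₂) (t x₃)
    N₂₃ r = proj₁ (proj₂ (ent _ r))

combine : ∀ (h : A → A → A → A) {R : Rel 4} → Preserves (ternary h) R →
          ∀ {t₁ t₂ t₃} → R t₁ → R t₂ → R t₃ → R (λ c → h (t₁ c) (t₂ c) (t₃ c))
combine h hR {t₁} {t₂} {t₃} r₁ r₂ r₃ =
  hR (t₁ ∷ t₂ ∷ t₃ ∷ []) (λ { zero → r₁ ; (suc zero) → r₂ ; (suc (suc zero)) → r₃ })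

-- A [(E ⇒ =),(φ₀)]-relation closed under h is odd: a tuple with both pairs equal,
-- combined with the two shape witnesses as h(t, tA, tB), has both pairs in E.
edgeImpliesEq-odd : ∀ (h : A → A → A → A) {R : Rel 4} → Preserves (ternary h) R →
                    HOrb h oEq oE oEq oE → HOrb h oEq oEq oE oE →
                    Entails R φ₀ → (∀ t → R t → E (t x₁) (t x₂) → t x₃ ≡ t x₄) →
                    ∀ {tA tB} → R tA → EdgeEq tA → R tB → EqEdge tB → Odd R
edgeImpliesEq-odd h {R} hR h=E= h==E ent impl {tA} {tB} rA (EA₁₂ , eqA₃₄) rB (eqB₁₂ , EB₃₄) t r with ent t r
... | isEdge E₁₂ , _ , isEdge E₃₄ = ⊥-elim (E-irrefl (subst (E (t x₃)) (sym (impl t r E₁₂)) E₃₄))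
... | isEdge E₁₂ , _ , isEq eq₃₄  = cong₂ _xor_ (parity-E E₁₂) (parity-≡ eq₃₄)
... | isEq eq₁₂  , _ , isEdge E₃₄ = cong₂ _xor_ (parity-≡ eq₁₂) (parity-E E₃₄)
... | isEq eq₁₂  , _ , isEq eq₃₄  = ⊥-elim (E-irrefl (subst (E (o x₃)) (sym o-eq₃₄) o-E₃₄))
  where
    o : Fin 4 → A
    o c = h (t c) (tA c) (tB c)
    o-E₁₂ : E (o x₁) (o x₂)
    o-E₁₂ = h=E= _ _ _ _ _ _ eq₁₂ EA₁₂ eqB₁₂
    o-eq₃₄ : o x₃ ≡ o x₄
    o-eq₃₄ = impl o (combine h {R} hR r rA rB) o-E₁₂
    o-E₃₄ : E (o x₃) (o x₄)
    o-E₃₄ = h==E _ _ _ _ _ _ eq₃₄ eqA₃₄ EB₃₄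

-- A [(= ⇒ E),(φ₀)]-relation closed under h is odd: a tuple with both pairs in E,
-- combined with the two shape witnesses as h(t, tB, tA), has both pairs equal.
eqImpliesEdge-odd : ∀ (h : A → A → A → A) {R : Rel 4} → Preserves (ternary h) R →
                    HOrb h oE oEq oE oEq → HOrb h oE oE oEq oEq →
                    Entails R φ₀ → (∀ t → R t → t x₁ ≡ t x₂ → E (t x₃) (t x₄)) →
                    ∀ {tA tB} → R tA → EdgeEq tA → R tB → EqEdge tB → Odd R
eqImpliesEdge-odd h {R} hR hE=E hEE= ent impl {tA} {tB} rA (EA₁₂ , eqA₃₄) rB (eqB₁₂ , EB₃₄) t r with ent t r
... | isEq eq₁₂  , _ , isEq eq₃₄  = ⊥-elim (E-irrefl (subst (E (t x₃)) (sym eq₃₄) (impl t r eq₁₂)))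
... | isEdge E₁₂ , _ , isEq eq₃₄  = cong₂ _xor_ (parity-E E₁₂) (parity-≡ eq₃₄)
... | isEq eq₁₂  , _ , isEdge E₃₄ = cong₂ _xor_ (parity-≡ eq₁₂) (parity-E E₃₄)
... | isEdge E₁₂ , _ , isEdge E₃₄ = ⊥-elim (E-irrefl (subst (E (o x₃)) (sym o-eq₃₄) o-E₃₄))
  where
    o : Fin 4 → A
    o c = h (t c) (tB c) (tA c)
    o-eq₁₂ : o x₁ ≡ o x₂
    o-eq₁₂ = hE=E _ _ _ _ _ _ E₁₂ eqB₁₂ EA₁₂
    o-E₃₄ : E (o x₃) (o x₄)
    o-E₃₄ = impl o (combine h {R} hR r rB rA) o-eq₁₂
    o-eq₃₄ : o x₃ ≡ o x₄
    o-eq₃₄ = hEE= _ _ _ _ _ _ E₃₄ EB₃₄ eqA₃₄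

-- In both cases efficient entailment and φ₀ supply one tuple of each shape,
-- h makes the relation odd, and the QNU polymorphism q then refutes it.
mainTheorem18 : (𝔸 : Expansion) (m : ℕ) (q : Op m) (h : A → A → A → A) →
    IsPolymorphism 𝔸 q → IsQNU q → IsOligopotent 𝔸 q →
    IsPolymorphism 𝔸 (ternary h) → IsCanonical h → NAbsorbing h → MinorityOnEEq h →
    ¬ PPDefinesImplRelation 𝔸 E _≡_ φ₀ × ¬ PPDefinesImplRelation 𝔸 _≡_ E φ₀
mainTheorem18 𝔸 m q h qPol qnu _ hPol _ _ (_ , _ , h=E= , h==E , _ , _ , hE=E , hEE=) =
  noEdgeImpliesEq , noEqImpliesEdge
  where
    noEdgeImpliesEq : ¬ PPDefinesImplRelation 𝔸 E _≡_ φ₀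
    noEdgeImpliesEq (ψ , (impl , (tA , rA , EA , eqA) , (tB , rB , ¬EB , ≢B)) , ent) =
      oddRelationNotPreserved q qPol qnu ψ odd ent rA (EA , eqA) rB shapeB
      where
        shapeB : EqEdge tB
        shapeB = E⁼-¬E (proj₁ (ent tB rB)) ¬EB , E⁼-≢ (proj₂ (proj₂ (ent tB rB))) ≢B
        odd : Odd ⟦ ψ ⟧PP
        odd = edgeImpliesEq-odd h (ppPreserved (ternary h) hPol ψ) h=E= h==E ent impl rA (EA , eqA) rB shapeB

    noEqImpliesEdge : ¬ PPDefinesImplRelation 𝔸 _≡_ E φ₀
    noEqImpliesEdge (ψ , (impl , (tB , rB , eqB , EB) , (tA , rA , ≢A , ¬EA)) , ent) =
      oddRelationNotPreserved q qPol qnu ψ odd ent rA shapeA rB (eqB , EB)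
      where
        shapeA : EdgeEq tA
        shapeA = E⁼-≢ (proj₁ (ent tA rA)) ≢A , E⁼-¬E (proj₂ (proj₂ (ent tA rA))) ¬EA
        odd : Odd ⟦ ψ ⟧PP
        odd = eqImpliesEdge-odd h (ppPreserved (ternary h) hPol ψ) hE=E hEE= ent impl rA shapeA rB (eqB , EB)
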